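{- Let $k\ge 0$ be an integer and $n=48k+22$; all arithmetic is modulo $n$. Define $c_1(r)=r$ for $0\le r\le n-1$. Define $c_2,c_3:\{0,\dots,n-1\}\to\mathbb{Z}_n$ by: for $0\le i\le 12k+5$, $c_2(2i)=30k+13+i(12k+6)$ and $c_3(2i)=30k+14+i(12k+7)$; for $0\le i\le 12k+4$, $c_2(2i+1)=12k+5+i(12k+6)$ and $c_3(2i+1)=24k+12+i(12k+7)$; and for $0\le r\le 24k+10$ and $\alpha=2,3$, $c_\alpha(n-1-r)=n-1-c_\alpha(r)$. For $\alpha=1,2,3$ let ${\cal L}_\alpha=[l_\alpha(r,j)]$ be the $n\times n$ array with $l_\alpha(r,j)\equiv c_\alpha(r)+j\pmod n$, $0\le r,j\le n-1$. Then ${\cal L}_1,{\cal L}_2,{\cal L}_3$ are three (cyclic) mutually nearly orthogonal Latin squares of order $n$, i.e. they are Latin squares and each pair of them is nearly orthogonal.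
   Context: A Latin square of order $n$ is an $n\times n$ array in which each row and each column contains each of the symbols $0,\dots,n-1$ exactly once. For Latin squares $L=[l(i,j)]$ and $M=[m(i,j)]$ of even order $n$ on symbols $\{0,\dots,n-1\}$, their superimposition is the $n\times n$ array $A=[(l(i,j),m(i,j))]$. $L$ and $M$ are nearly orthogonal if in $A$ every ordered pair $(x,y)$ with $0\le x,y\le n-1$, $x\ne y$, occurs at least once, and each ordered pair $(x,x+n/2)$ (second coordinate taken modulo $n$) occurs exactly twice. A set of Latin squares is mutually nearly orthogonal if every two of them are nearly orthogonal. -}

module Defs where

open import Data.Nat using (ℕ; zero; suc; _+_; _*_; _∸_; _<?_; NonZero)
open import Data.Nat.DivMod using (_/_; _%_; _mod_)
open import Data.Fin using (Fin; toℕ)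
open import Data.Product using (Σ; ∃; ∃-syntax; _×_; _,_)
open import Relation.Binary.PropositionalEquality using (_≡_; _≢_)
open import Relation.Nullary using (¬_; yes; no)

Square : ℕ → Set
Square n = Fin n → Fin n → Fin n

ExactlyOnce : ∀ {n} → (Fin n → Fin n) → Fin n → Set
ExactlyOnce f x = ∃[ j ] (f j ≡ x × (∀ j′ → f j′ ≡ x → j′ ≡ j))

IsLatinSquare : ∀ {n} → Square n → Set
IsLatinSquare {n} L =
  (∀ (i x : Fin n) → ExactlyOnce (λ j → L i j) x) ×
  (∀ (j x : Fin n) → ExactlyOnce (λ i → L i j) x)

PairAt : ∀ {n} → Square n → Square n → Fin n → Fin n → Fin n → Fin n → Set
PairAt L M x y i j = (L i j ≡ x) × (M i j ≡ y)

OccursAtLeastOnce : ∀ {n} → Square n → Square n → Fin n → Fin n → Set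
OccursAtLeastOnce {n} L M x y = ∃[ i ] ∃[ j ] PairAt L M x y i j

OccursExactlyTwice : ∀ {n} → Square n → Square n → Fin n → Fin n → Set
OccursExactlyTwice {n} L M x y =
  Σ (Fin n × Fin n) λ { (i₁ , j₁) → Σ (Fin n × Fin n) λ { (i₂ , j₂) →
    PairAt L M x y i₁ j₁ × PairAt L M x y i₂ j₂ × ((i₁ , j₁) ≢ (i₂ , j₂)) ×
    (∀ i j → PairAt L M x y i j → ((i , j) ≡ (i₁ , j₁)) Data.Sum.⊎ ((i , j) ≡ (i₂ , j₂))) } }
  where import Data.Sum

NearlyOrthogonal : (n : ℕ) → .{{_ : NonZero n}} → Square n → Square n → Set
NearlyOrthogonal n L M =
  (∀ (x y : Fin n) → x ≢ y → OccursAtLeastOnce L M x y) ×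
  (∀ (x : Fin n) → OccursExactlyTwice L M x ((toℕ x + n / 2) mod n))

-- n = 48k+22, written as suc (48k+21) so that NonZero n is found automatically
ord : ℕ → ℕ
ord k = suc (48 * k + 21)

-- values on the first half 0 ≤ r ≤ 24k+10 (as naturals, before reduction mod n)
c₂-low c₃-low : ℕ → ℕ → ℕ
c₂-low k r with r % 2
... | 0 = (30 * k + 13) + (r / 2) * (12 * k + 6)
... | _ = (12 * k + 5) + (r / 2) * (12 * k + 6)
c₃-low k r with r % 2
... | 0 = (30 * k + 14) + (r / 2) * (12 * k + 7)
... | _ = (24 * k + 12) + (r / 2) * (12 * k + 7)

extend : (k : ℕ) → (ℕ → ℕ → ℕ) → Fin (ord k) → Fin (ord k)
extend k low r with toℕ r <? ord k / 2
... | yes _ = low k (toℕ r) mod ord k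
... | no  _ = (ord k ∸ 1 ∸ toℕ (low k (ord k ∸ 1 ∸ toℕ r) mod ord k)) mod ord k

c₁ c₂ c₃ : (k : ℕ) → Fin (ord k) → Fin (ord k)
c₁ k r = r
c₂ k = extend k c₂-low
c₃ k = extend k c₃-low

cyclicSquare : (k : ℕ) → (Fin (ord k) → Fin (ord k)) → Square (ord k)
cyclicSquare k c r j = (toℕ (c r) + toℕ j) mod ord k

L₁ L₂ L₃ : (k : ℕ) → Square (ord k)
L₁ k = cyclicSquare k (c₁ k)
L₂ k = cyclicSquare k (c₂ k)
L₃ k = cyclicSquare k (c₃ k)

-- Row r of the cyclic square of c : ℤₙ → ℤₙ is j ↦ c(r) + j, so the square is Latin exactly when c
-- is a bijection, and (x, y) occurs in the superimposition of the squares of a and b once for every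
-- row r with b(r) - a(r) ≡ y - x.  Near orthogonality therefore asks the difference b - a to miss 0,
-- to take the value n/2 on exactly two rows and to be injective on the others.
--
-- With h = n/2 = 24k+11, each of c₁, c₂, c₃ and each of their differences F is, on the rows r < h,
-- an arithmetic progression A + iS on the even rows 2i and B + iS on the odd rows 2i+1, and satisfies
-- F(n-1-r) ≡ e - F(r).  The step S is invertible modulo h, so two rows can only share their value if
-- X + uS ≡ 0 (mod n) for one of a few shifts X, linear or quadratic in k, and a bounded u ≥ 0.  Modulo h
-- the only candidate is u ≡ -X/S, and for the data of the construction it is either out of range or
-- leaves the residue h modulo n, except for one pair of mirror rows on which a difference is n/2.

module Submission where

open import Defs
open import Data.Nat using (ℕ)
open import Data.Product using (_×_)

open import Data.Nat as ℕ using (zero; suc; z≤n; s≤s; NonZero; _<_; _≤_)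
import Data.Nat.Properties as ℕ
open import Data.Nat.DivMod using (_/_; _%_; _mod_; m*n%n≡0; m*n/n≡m; [m+kn]%n≡m%n; +-distrib-/-∣ʳ)
open import Data.Nat.Divisibility using (>⇒∤) renaming (divides to ℕ-divides)
import Data.Nat.Tactic.RingSolver as ℕ-Ring
open import Data.Fin using (Fin; toℕ; fromℕ<; punchOut; opposite)
open import Data.Fin.Properties using (toℕ-fromℕ<; toℕ<n; toℕ-injective; any?; injective⇒≤; punchOut-injective; opposite-prop; opposite-involutive)
  renaming (_≟_ to _≟ᶠ_)
open import Data.Integer using (ℤ; +_; -_; 0ℤ; _+_; _-_; _*_)
open import Data.Integer.Properties using (pos-+; pos-*; m-n≡m⊖n; ⊖-≥) renaming (+-comm to ℤ+-comm)
open import Data.Integer.DivMod using (_%ℕ_; _/ℕ_; n%ℕd<d; a≡a%ℕn+[a/ℕn]*n)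
open import Data.Integer.Divisibility.Signed using (_∣_; divides; ∣-trans; ∣m∣n⇒∣m+n; ∣m⇒∣-m; ∣n⇒∣m*n; ∣⇒∣ᵤ)
open import Data.Integer.Tactic.RingSolver using (solve-∀; solve)
open import Data.Empty using (⊥; ⊥-elim)
open import Data.List using (_∷_; [])
open import Data.Product using (∃; _,_; proj₁; proj₂)
open import Data.Sum using (_⊎_; inj₁; inj₂) renaming (map to ⊎-map; map₂ to ⊎-map₂)
open import Function using (_∘_; id)
open import Function.Definitions using (Injective)
open import Relation.Binary using (Setoid; tri<; tri≈; tri>)
import Relation.Binary.Reasoning.Setoid as SetoidReasoning
open import Relation.Binary.PropositionalEquality
open import Relation.Nullary using (¬_; Dec; yes; no; contradiction)
open import Relation.Nullary.Decidable using (True; toWitness)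

infix 4 _≡_[mod_]

-- A record rather than the bare divisibility, so that a, b and m can be inferred from a proof.
record _≡_[mod_] (a b m : ℤ) : Set where
  constructor congruent
  field difference-divisible : m ∣ a - b

open _≡_[mod_] public

module _ {m : ℤ} where

  by-identity : ∀ {x a b} → x ≡ a - b → m ∣ x → a ≡ b [mod m ]
  by-identity refl = congruent

  mod-refl : ∀ {a} → a ≡ a [mod m ]
  mod-refl {a} = by-identity (lemma a m) (divides 0ℤ refl)
    where
    lemma : ∀ a m → 0ℤ * m ≡ a - a
    lemma = solve-∀

  ≡⇒mod : ∀ {a b} → a ≡ b → a ≡ b [mod m ]
  ≡⇒mod refl = mod-refl

  mod-sym : ∀ {a b} → a ≡ b [mod m ] → b ≡ a [mod m ]
  mod-sym {a} {b} (congruent p) = by-identity (lemma a b) (∣m⇒∣-m p)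
    where
    lemma : ∀ a b → - (a - b) ≡ b - a
    lemma = solve-∀

  mod-trans : ∀ {a b c} → a ≡ b [mod m ] → b ≡ c [mod m ] → a ≡ c [mod m ]
  mod-trans {a} {b} {c} (congruent p) (congruent q) = by-identity (lemma a b c) (∣m∣n⇒∣m+n p q)
    where
    lemma : ∀ a b c → (a - b) + (b - c) ≡ a - c
    lemma = solve-∀

  mod-+ : ∀ {a b c d} → a ≡ b [mod m ] → c ≡ d [mod m ] → a + c ≡ b + d [mod m ]
  mod-+ {a} {b} {c} {d} (congruent p) (congruent q) = by-identity (lemma a b c d) (∣m∣n⇒∣m+n p q)
    where
    lemma : ∀ a b c d → (a - b) + (c - d) ≡ (a + c) - (b + d)
    lemma = solve-∀

  mod-neg : ∀ {a b} → a ≡ b [mod m ] → - a ≡ - b [mod m ]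
  mod-neg {a} {b} (congruent p) = by-identity (lemma a b) (∣m⇒∣-m p)
    where
    lemma : ∀ a b → - (a - b) ≡ - a - - b
    lemma = solve-∀

  mod-cancel-unit : ∀ {t s a b} → t * s ≡ + 1 [mod m ] → a * s ≡ b * s [mod m ] → a ≡ b [mod m ]
  mod-cancel-unit {t} {s} {a} {b} (congruent ts≡1) (congruent as≡bs) =
    by-identity (lemma t s a b) (∣m∣n⇒∣m+n (∣n⇒∣m*n t as≡bs) (∣n⇒∣m*n (- (a - b)) ts≡1))
    where
    lemma : ∀ t s a b → t * (a * s - b * s) + - (a - b) * (t * s - + 1) ≡ a - b
    lemma = solve-∀

mod-+-cancelˡ : ∀ {m c a b} → c + a ≡ c + b [mod m ] → a ≡ b [mod m ]
mod-+-cancelˡ {m} {c} {a} {b} (congruent p) = by-identity (lemma c a b) p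
  where
  lemma : ∀ c a b → (c + a) - (c + b) ≡ a - b
  lemma = solve-∀

mod-+-cancelʳ : ∀ {m c a b} → a + c ≡ b + c [mod m ] → a ≡ b [mod m ]
mod-+-cancelʳ {m} {c} {a} {b} (congruent p) = by-identity (lemma c a b) p
  where
  lemma : ∀ c a b → (a + c) - (b + c) ≡ a - b
  lemma = solve-∀

mod-−-cancelˡ : ∀ {m c a b} → c - a ≡ c - b [mod m ] → a ≡ b [mod m ]
mod-−-cancelˡ {m} {c} {a} {b} (congruent p) = by-identity (lemma c a b) (∣m⇒∣-m p)
  where
  lemma : ∀ c a b → - ((c - a) - (c - b)) ≡ a - b
  lemma = solve-∀

mod-−⇒+ : ∀ {m a b c} → a ≡ c - b [mod m ] → a + b ≡ c [mod m ]
mod-−⇒+ {m} {a} {b} {c} (congruent p) = by-identity (lemma a b c) p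
  where
  lemma : ∀ a b c → a - (c - b) ≡ (a + b) - c
  lemma = solve-∀

mod-divisor : ∀ {d m a b} → d ∣ m → a ≡ b [mod m ] → a ≡ b [mod d ]
mod-divisor d∣m (congruent p) = congruent (∣-trans d∣m p)

mod-setoid : ℤ → Setoid _ _
mod-setoid m = record
  { Carrier = ℤ
  ; _≈_ = _≡_[mod m ]
  ; isEquivalence = record { refl = mod-refl ; sym = mod-sym ; trans = mod-trans }
  }

private
  double : ∀ i → i ℕ.+ i ≡ i ℕ.* 2
  double i = lemma i
    where
    lemma : ∀ i → i ℕ.+ i ≡ i ℕ.* 2
    lemma = ℕ-Ring.solve-∀

halve-even : ∀ i → (i ℕ.+ i) % 2 ≡ 0 × (i ℕ.+ i) / 2 ≡ i
halve-even i = trans (cong (_% 2) (double i)) (m*n%n≡0 i 2) , trans (cong (_/ 2) (double i)) (m*n/n≡m i 2)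

halve-odd : ∀ i → suc (i ℕ.+ i) % 2 ≡ 1 × suc (i ℕ.+ i) / 2 ≡ i
halve-odd i = trans (cong (λ x → suc x % 2) (double i)) ([m+kn]%n≡m%n 1 i 2) ,
              trans (cong (λ x → suc x / 2) (double i)) (trans (+-distrib-/-∣ʳ 1 {i ℕ.* 2} {2} (ℕ-divides i refl)) (m*n/n≡m i 2))

no-multiple-below : ∀ {m u w} → u < w → w < m → ¬ + w ≡ + u [mod + m ]
no-multiple-below {m} {u} {w} u<w w<m (congruent m∣w-u) =
  >⇒∤ {{ℕ.>-nonZero (ℕ.m<n⇒0<n∸m u<w)}} (ℕ.≤-<-trans (ℕ.m∸n≤m w u) w<m)
    (∣⇒∣ᵤ (subst (+ m ∣_) (trans (m-n≡m⊖n w u) (⊖-≥ (ℕ.<⇒≤ u<w))) m∣w-u))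

congruent⇒≡ : ∀ {m u w} → u < m → w < m → + u ≡ + w [mod + m ] → u ≡ w
congruent⇒≡ {m} {u} {w} u<m w<m u≡w with ℕ.<-cmp u w
... | tri< u<w _ _ = contradiction (mod-sym u≡w) (no-multiple-below u<w w<m)
... | tri≈ _ u≡w _ = u≡w
... | tri> _ _ w<u = contradiction u≡w (no-multiple-below w<u u<m)

module _ (n : ℕ) .{{_ : NonZero n}} where

  residue : ℤ → Fin n
  residue a = fromℕ< (n%ℕd<d a n)

  residue-congruent : ∀ a → + toℕ (residue a) ≡ a [mod + n ]
  residue-congruent a = by-identity identity (divides (- (a /ℕ n)) refl)
    where
    identity : - (a /ℕ n) * + n ≡ + toℕ (residue a) - a
    identity rewrite toℕ-fromℕ< (n%ℕd<d a n) = begin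
      - (a /ℕ n) * + n                                      ≡⟨ lemma (+ (a %ℕ n)) (a /ℕ n) (+ n) ⟩
      + (a %ℕ n) - (+ (a %ℕ n) + (a /ℕ n) * + n)             ≡⟨ cong (λ x → + (a %ℕ n) - x) (a≡a%ℕn+[a/ℕn]*n a n) ⟨
      + (a %ℕ n) - a                                        ∎
      where
      open ≡-Reasoning
      lemma : ∀ r q n → - q * n ≡ r - (r + q * n)
      lemma = solve-∀

  toℕ-mod : ∀ a → + toℕ (a mod n) ≡ + a [mod + n ]
  toℕ-mod a = residue-congruent (+ a)

  congruent⇒fin≡ : ∀ {a b : Fin n} → + toℕ a ≡ + toℕ b [mod + n ] → a ≡ b
  congruent⇒fin≡ = toℕ-injective ∘ congruent⇒≡ (toℕ<n _) (toℕ<n _)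

injective⇒surjective : ∀ {m} (f : Fin m → Fin m) → Injective _≡_ _≡_ f → ∀ y → ∃ λ x → f x ≡ y
injective⇒surjective {suc m} f f-injective y with any? (λ x → f x ≟ᶠ y)
... | yes hit = hit
... | no miss = contradiction (injective⇒≤ punched-injective) ℕ.1+n≰n
  where
  misses : ∀ x → y ≢ f x
  misses x y≡fx = miss (x , sym y≡fx)
  punched-injective : Injective _≡_ _≡_ (λ x → punchOut (misses x))
  punched-injective {a} {b} = f-injective ∘ punchOut-injective (misses a) (misses b)

injective⇒exactlyOnce : ∀ {m} {f : Fin m → Fin m} → Injective _≡_ _≡_ f → ∀ y → ExactlyOnce f y
injective⇒exactlyOnce {f = f} f-injective y with injective⇒surjective f f-injective y
... | x , fx≡y = x , fx≡y , λ x′ fx′≡y → f-injective (trans fx′≡y (sym fx≡y))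

-- Redirecting r₂ to the missed value z makes f injective, hence onto.
hits-all-but : ∀ {m} (f : Fin m → Fin m) (z r₂ : Fin m) → (∀ r → f r ≢ z) →
  (∀ {r r′} → f r ≡ f r′ → r ≡ r′ ⊎ r ≡ r₂ ⊎ r′ ≡ r₂) → ∀ v → v ≢ z → ∃ λ r → f r ≡ v
hits-all-but {m} f z r₂ misses-z almost-injective v v≢z = r , unredirect (r ≟ᶠ r₂) hit
  where
  redirect : ∀ r → Dec (r ≡ r₂) → Fin m
  redirect r (yes _) = z
  redirect r (no _)  = f r
  redirected : Fin m → Fin m
  redirected r = redirect r (r ≟ᶠ r₂)
  redirect-injective : ∀ {a b} (a? : Dec (a ≡ r₂)) (b? : Dec (b ≡ r₂)) → redirect a a? ≡ redirect b b? → a ≡ b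
  redirect-injective (yes a≡r₂) (yes b≡r₂) _ = trans a≡r₂ (sym b≡r₂)
  redirect-injective (yes _) (no _) z≡fb = contradiction (sym z≡fb) (misses-z _)
  redirect-injective (no _) (yes _) fa≡z = contradiction fa≡z (misses-z _)
  redirect-injective (no a≢r₂) (no b≢r₂) fa≡fb with almost-injective fa≡fb
  ... | inj₁ a≡b = a≡b
  ... | inj₂ (inj₁ a≡r₂) = contradiction a≡r₂ a≢r₂
  ... | inj₂ (inj₂ b≡r₂) = contradiction b≡r₂ b≢r₂
  preimage = injective⇒surjective redirected (λ {a} {b} → redirect-injective (a ≟ᶠ r₂) (b ≟ᶠ r₂)) v
  r = proj₁ preimage
  hit = proj₂ preimage
  unredirect : (r? : Dec (r ≡ r₂)) → redirect r r? ≡ v → f r ≡ v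
  unredirect (yes _) z≡v = contradiction (sym z≡v) v≢z
  unredirect (no _) fr≡v = fr≡v

module _ (n : ℕ) .{{_ : NonZero n}} where

  open SetoidReasoning (mod-setoid (+ n))

  cyclic : (Fin n → Fin n) → Square n
  cyclic c r j = (toℕ (c r) ℕ.+ toℕ j) mod n

  cyclic-entry : ∀ c r j → + toℕ (cyclic c r j) ≡ + toℕ (c r) + + toℕ j [mod + n ]
  cyclic-entry c r j =
    subst (λ x → + toℕ (cyclic c r j) ≡ x [mod + n ]) (pos-+ (toℕ (c r)) (toℕ j)) (toℕ-mod n _)

  cyclic-entry⁻¹ : ∀ {c r j x} → + toℕ x ≡ + toℕ (c r) + + toℕ j [mod + n ] → cyclic c r j ≡ x
  cyclic-entry⁻¹ {c} {r} {j} x≡ = congruent⇒fin≡ n (mod-trans (cyclic-entry c r j) (mod-sym x≡))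

  cyclic-row-injective : ∀ c r → Injective _≡_ _≡_ (cyclic c r)
  cyclic-row-injective c r {j} {j′} eq = congruent⇒fin≡ n (mod-+-cancelˡ {c = + toℕ (c r)} (begin
    + toℕ (c r) + + toℕ j    ≈⟨ cyclic-entry c r j ⟨
    + toℕ (cyclic c r j)     ≡⟨ cong (+_ ∘ toℕ) eq ⟩
    + toℕ (cyclic c r j′)    ≈⟨ cyclic-entry c r j′ ⟩
    + toℕ (c r) + + toℕ j′   ∎))

  cyclic-column-injective : ∀ {c} → Injective _≡_ _≡_ c → ∀ j → Injective _≡_ _≡_ (λ r → cyclic c r j)
  cyclic-column-injective {c} c-injective j {r} {r′} eq = c-injective (congruent⇒fin≡ n (mod-+-cancelʳ {c = + toℕ j} (begin
    + toℕ (c r) + + toℕ j    ≈⟨ cyclic-entry c r j ⟨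
    + toℕ (cyclic c r j)     ≡⟨ cong (+_ ∘ toℕ) eq ⟩
    + toℕ (cyclic c r′ j)    ≈⟨ cyclic-entry c r′ j ⟩
    + toℕ (c r′) + + toℕ j   ∎)))

  cyclic-isLatinSquare : ∀ {c} → Injective _≡_ _≡_ c → IsLatinSquare (cyclic c)
  cyclic-isLatinSquare {c} c-injective =
    (λ r → injective⇒exactlyOnce (cyclic-row-injective c r)) ,
    (λ j → injective⇒exactlyOnce (cyclic-column-injective c-injective j))

  column : (Fin n → Fin n) → Fin n → Fin n → Fin n
  column c r x = residue n (+ toℕ x - + toℕ (c r))

  cyclic-column : ∀ c r x → cyclic c r (column c r x) ≡ x
  cyclic-column c r x = cyclic-entry⁻¹ {c} {r} {column c r x} (begin
    + toℕ x                                      ≡⟨ lemma (+ toℕ x) (+ toℕ (c r)) ⟩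
    + toℕ (c r) + (+ toℕ x - + toℕ (c r))        ≈⟨ mod-+ {a = + toℕ (c r)} mod-refl (residue-congruent n (+ toℕ x - + toℕ (c r))) ⟨
    + toℕ (c r) + + toℕ (column c r x)           ∎)
    where
    lemma : ∀ x c → x ≡ c + (x - c)
    lemma = solve-∀

  module _ (ca cb : Fin n → Fin n) where

    difference : Fin n → ℤ
    difference r = + toℕ (cb r) - + toℕ (ca r)

    pair-difference : ∀ {r j x y} → cyclic ca r j ≡ x → cyclic cb r j ≡ y →
                      difference r ≡ + toℕ y - + toℕ x [mod + n ]
    pair-difference {r} {j} {x} {y} refl refl = begin
      + toℕ (cb r) - + toℕ (ca r)                                 ≡⟨ lemma (+ toℕ (cb r)) (+ toℕ (ca r)) (+ toℕ j) ⟩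
      (+ toℕ (cb r) + + toℕ j) - (+ toℕ (ca r) + + toℕ j)         ≈⟨ mod-+ (cyclic-entry cb r j) (mod-neg (cyclic-entry ca r j)) ⟨
      + toℕ (cyclic cb r j) - + toℕ (cyclic ca r j)               ∎
      where
      lemma : ∀ b a j → b - a ≡ (b + j) - (a + j)
      lemma = solve-∀

    pair-from-difference : ∀ {r j x y} → cyclic ca r j ≡ x → difference r ≡ + toℕ y - + toℕ x [mod + n ] →
                           cyclic cb r j ≡ y
    pair-from-difference {r} {j} {x} {y} refl d≡y-x = cyclic-entry⁻¹ {cb} {r} {j} (begin
      + toℕ y                                                    ≡⟨ lemma (+ toℕ y) (+ toℕ x) ⟩
      (+ toℕ y - + toℕ x) + + toℕ x                              ≈⟨ mod-+ (mod-sym d≡y-x) (cyclic-entry ca r j) ⟩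
      (+ toℕ (cb r) - + toℕ (ca r)) + (+ toℕ (ca r) + + toℕ j)   ≡⟨ lemma′ (+ toℕ (cb r)) (+ toℕ (ca r)) (+ toℕ j) ⟩
      + toℕ (cb r) + + toℕ j                                     ∎)
      where
      lemma : ∀ y x → y ≡ (y - x) + x
      lemma = solve-∀
      lemma′ : ∀ b a j → (b - a) + (a + j) ≡ b + j
      lemma′ = solve-∀

    -- (x, y) occurs in row r iff difference r ≡ y - x, and then exactly in column (column ca r x).
    cyclic-nearlyOrthogonal : ∀ r₁ r₂ → r₁ ≢ r₂ →
      difference r₁ ≡ + (n / 2) [mod + n ] → difference r₂ ≡ + (n / 2) [mod + n ] →
      (∀ r → ¬ difference r ≡ 0ℤ [mod + n ]) →
      (∀ {r r′} → difference r ≡ difference r′ [mod + n ] → r ≡ r′ ⊎ r ≡ r₂ ⊎ r′ ≡ r₂) →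
      NearlyOrthogonal n (cyclic ca) (cyclic cb)
    cyclic-nearlyOrthogonal r₁ r₂ r₁≢r₂ d₁≡half d₂≡half no-zero almost-injective = every-pair , half-pairs
      where
      δ : Fin n → Fin n
      δ r = residue n (difference r)

      δ-congruent : ∀ {r v} → δ r ≡ v → difference r ≡ + toℕ v [mod + n ]
      δ-congruent refl = mod-sym (residue-congruent n _)

      δ-misses-zero : ∀ r → δ r ≢ residue n 0ℤ
      δ-misses-zero r δr≡z = no-zero r (mod-trans (δ-congruent δr≡z) (residue-congruent n 0ℤ))

      δ-almost-injective : ∀ {r r′} → δ r ≡ δ r′ → r ≡ r′ ⊎ r ≡ r₂ ⊎ r′ ≡ r₂
      δ-almost-injective {r} {r′} δr≡δr′ =
        almost-injective (mod-trans (δ-congruent δr≡δr′) (mod-sym (δ-congruent {r′} refl)))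

      every-pair : ∀ x y → x ≢ y → OccursAtLeastOnce (cyclic ca) (cyclic cb) x y
      every-pair x y x≢y = r , column ca r x , cyclic-column ca r x ,
                           pair-from-difference (cyclic-column ca r x) (mod-trans (δ-congruent δr≡v) (residue-congruent n _))
        where
        v = residue n (+ toℕ y - + toℕ x)
        v≢z : v ≢ residue n 0ℤ
        v≢z v≡z = x≢y (sym (congruent⇒fin≡ n (by-identity (lemma (+ toℕ y) (+ toℕ x)) (difference-divisible y-x≡0))))
          where
          y-x≡0 : + toℕ y - + toℕ x ≡ 0ℤ [mod + n ]
          y-x≡0 = mod-trans (mod-sym (residue-congruent n (+ toℕ y - + toℕ x)))
                    (subst (λ w → + toℕ w ≡ 0ℤ [mod + n ]) (sym v≡z) (residue-congruent n 0ℤ))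
          lemma : ∀ y x → (y - x) - 0ℤ ≡ y - x
          lemma = solve-∀
        hit = hits-all-but δ (residue n 0ℤ) r₂ δ-misses-zero δ-almost-injective v v≢z
        r = proj₁ hit
        δr≡v = proj₂ hit

      half-pairs : ∀ x → OccursExactlyTwice (cyclic ca) (cyclic cb) x ((toℕ x ℕ.+ n / 2) mod n)
      half-pairs x = (r₁ , column ca r₁ x) , (r₂ , column ca r₂ x) ,
                     cell r₁ d₁≡half , cell r₂ d₂≡half , r₁≢r₂ ∘ cong proj₁ , only-cells
        where
        y = (toℕ x ℕ.+ n / 2) mod n
        half≡y-x : + (n / 2) ≡ + toℕ y - + toℕ x [mod + n ]
        half≡y-x = begin
          + (n / 2)                       ≡⟨ lemma (+ toℕ x) (+ (n / 2)) ⟩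
          (+ toℕ x + + (n / 2)) - + toℕ x  ≡⟨ cong (_- + toℕ x) (pos-+ (toℕ x) (n / 2)) ⟨
          + (toℕ x ℕ.+ n / 2) - + toℕ x    ≈⟨ mod-+ (toℕ-mod n (toℕ x ℕ.+ n / 2)) (mod-refl {a = - + toℕ x}) ⟨
          + toℕ y - + toℕ x               ∎
          where
          lemma : ∀ x h → h ≡ (x + h) - x
          lemma = solve-∀
        cell : ∀ r → difference r ≡ + (n / 2) [mod + n ] → PairAt (cyclic ca) (cyclic cb) x y r (column ca r x)
        cell r d≡half = cyclic-column ca r x , pair-from-difference (cyclic-column ca r x) (mod-trans d≡half half≡y-x)
        only-cells : ∀ i j → PairAt (cyclic ca) (cyclic cb) x y i j →
                     (i , j) ≡ (r₁ , column ca r₁ x) ⊎ (i , j) ≡ (r₂ , column ca r₂ x)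
        only-cells i j (a≡x , b≡y) = place (almost-injective (mod-trans (pair-difference {i} {j} a≡x b≡y)
                                                                         (mod-sym (mod-trans d₁≡half half≡y-x))))
          where
          same-column : ∀ r → i ≡ r → j ≡ column ca r x
          same-column r refl = cyclic-row-injective ca i (trans a≡x (sym (cyclic-column ca i x)))
          place : i ≡ r₁ ⊎ i ≡ r₂ ⊎ r₁ ≡ r₂ → (i , j) ≡ (r₁ , column ca r₁ x) ⊎ (i , j) ≡ (r₂ , column ca r₂ x)
          place (inj₁ i≡r₁) = inj₁ (cong₂ _,_ i≡r₁ (same-column r₁ i≡r₁))
          place (inj₂ (inj₁ i≡r₂)) = inj₂ (cong₂ _,_ i≡r₂ (same-column r₂ i≡r₂))
          place (inj₂ (inj₂ r₁≡r₂)) = contradiction r₁≡r₂ r₁≢r₂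

module Construction (k : ℕ) where

  n : ℕ
  n = ord k

  lin : ℕ → ℕ → ℕ
  lin a b = a ℕ.* k ℕ.+ b

  h maxE maxO : ℕ
  h = lin 24 11
  maxE = lin 12 5
  maxO = lin 12 4

  -- n and h as integer polynomials in κ, the form in which the ring solver can use them
  κ 𝐧 𝐡 : ℤ
  κ = + k
  𝐧 = + 48 * κ + + 22
  𝐡 = + 24 * κ + + 11

  +lin : ∀ a b → + lin a b ≡ + a * κ + + b
  +lin a b = trans (pos-+ (a ℕ.* k) b) (cong (_+ + b) (pos-* a k))

  +n : + n ≡ 𝐧
  +n = trans (pos-+ 1 (lin 48 21)) (trans (cong (λ z → + 1 + z) (+lin 48 21)) (lemma κ))
    where
    lemma : ∀ x → + 1 + (+ 48 * x + + 21) ≡ + 48 * x + + 22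
    lemma = solve-∀

  𝐡∣𝐧 : 𝐡 ∣ 𝐧
  𝐡∣𝐧 = divides (+ 2) (lemma κ)
    where
    lemma : ∀ x → + 48 * x + + 22 ≡ + 2 * (+ 24 * x + + 11)
    lemma = solve-∀

  n/2≡h : n / 2 ≡ h
  n/2≡h = trans (cong (_/ 2) (lemma k)) (m*n/n≡m h 2)
    where
    lemma : ∀ k → suc (48 ℕ.* k ℕ.+ 21) ≡ (24 ℕ.* k ℕ.+ 11) ℕ.* 2
    lemma = ℕ-Ring.solve-∀

  lin-< : ∀ a a′ b b′ {a≤a′ : True (a ℕ.≤? a′)} {b<b′ : True (suc b ℕ.≤? b′)} → lin a b < lin a′ b′
  lin-< a a′ b b′ {a≤a′} {b<b′} =
    subst (ℕ._≤ lin a′ b′) (ℕ.+-suc (a ℕ.* k) b) (ℕ.+-mono-≤ (ℕ.*-monoˡ-≤ k (toWitness a≤a′)) (toWitness b<b′))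

  h<n : h < n
  h<n = ℕ.<-trans (lin-< 24 48 11 21) ℕ.≤-refl

  lin<h : ∀ a b {a≤24 : True (a ℕ.≤? 24)} {b≤10 : True (suc b ℕ.≤? 11)} → lin a b < h
  lin<h a b {a≤24} {b≤10} = lin-< a 24 b 11 {a≤24} {b≤10}

  private
    sum-≤ : ∀ {i j a b c} → i ≤ a → j ≤ b → a ℕ.+ b ≡ c → i ℕ.+ j ≤ c
    sum-≤ i≤a j≤b refl = ℕ.+-mono-≤ i≤a j≤b

  maxE+maxE : maxE ℕ.+ maxE ≡ lin 24 10
  maxE+maxE = lemma k
    where
    lemma : ∀ k → (12 ℕ.* k ℕ.+ 5) ℕ.+ (12 ℕ.* k ℕ.+ 5) ≡ 24 ℕ.* k ℕ.+ 10
    lemma = ℕ-Ring.solve-∀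

  maxE+maxO : maxE ℕ.+ maxO ≡ lin 24 9
  maxE+maxO = lemma k
    where
    lemma : ∀ k → (12 ℕ.* k ℕ.+ 5) ℕ.+ (12 ℕ.* k ℕ.+ 4) ≡ 24 ℕ.* k ℕ.+ 9
    lemma = ℕ-Ring.solve-∀

  maxO+maxO : maxO ℕ.+ maxO ≡ lin 24 8
  maxO+maxO = lemma k
    where
    lemma : ∀ k → (12 ℕ.* k ℕ.+ 4) ℕ.+ (12 ℕ.* k ℕ.+ 4) ≡ 24 ℕ.* k ℕ.+ 8
    lemma = ℕ-Ring.solve-∀

  data Low (x : ℕ) : Set where
    even : ∀ i → i ≤ maxE → x ≡ i ℕ.+ i → Low x
    odd  : ∀ i → i ≤ maxO → x ≡ suc (i ℕ.+ i) → Low x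

  Low⇒<h : ∀ {x} → Low x → x < h
  Low⇒<h (even i i≤maxE refl) = ℕ.≤-<-trans (sum-≤ i≤maxE i≤maxE maxE+maxE) (lin<h 24 10)
  Low⇒<h (odd i i≤maxO refl) =
    ℕ.≤-<-trans (s≤s (sum-≤ i≤maxO i≤maxO maxO+maxO)) (subst (ℕ._< h) (ℕ.+-suc (24 ℕ.* k) 8) (lin<h 24 9))

  parity : ∀ x → ∃ λ i → x ≡ i ℕ.+ i ⊎ x ≡ suc (i ℕ.+ i)
  parity zero = 0 , inj₁ refl
  parity (suc x) with parity x
  ... | i , inj₁ refl = i , inj₂ refl
  ... | i , inj₂ refl = suc i , inj₁ (cong suc (sym (ℕ.+-suc i i)))

  <h⇒Low : ∀ {x} → x < h → Low x
  <h⇒Low {x} x<h with parity x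
  ... | i , inj₁ refl = even i (half-bound (i ℕ.≤? maxE)) refl
    where
    half-bound : Dec (i ≤ maxE) → i ≤ maxE
    half-bound (yes i≤maxE) = i≤maxE
    half-bound (no i≰maxE) = ⊥-elim (ℕ.<-asym x<h (subst (ℕ._≤ x) (lemma k) (ℕ.+-mono-≤ (ℕ.≰⇒> i≰maxE) (ℕ.≰⇒> i≰maxE))))
      where
      lemma : ∀ k → suc (12 ℕ.* k ℕ.+ 5) ℕ.+ suc (12 ℕ.* k ℕ.+ 5) ≡ suc (24 ℕ.* k ℕ.+ 11)
      lemma = ℕ-Ring.solve-∀
  ... | i , inj₂ refl = odd i (half-bound (i ℕ.≤? maxO)) refl
    where
    half-bound : Dec (i ≤ maxO) → i ≤ maxO
    half-bound (yes i≤maxO) = i≤maxO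
    half-bound (no i≰maxO) = ⊥-elim (ℕ.<⇒≱ x<h (subst (ℕ._≤ x) (lemma k) (s≤s (ℕ.+-mono-≤ (ℕ.≰⇒> i≰maxO) (ℕ.≰⇒> i≰maxO)))))
      where
      lemma : ∀ k → suc (suc (12 ℕ.* k ℕ.+ 4) ℕ.+ suc (12 ℕ.* k ℕ.+ 4)) ≡ 24 ℕ.* k ℕ.+ 11
      lemma = ℕ-Ring.solve-∀

  opposite-sum : ∀ r → toℕ (opposite r) ℕ.+ toℕ r ≡ lin 48 21
  opposite-sum r = trans (cong (ℕ._+ toℕ r) (opposite-prop r)) (ℕ.m∸n+n≡m (ℕ.≤-pred (toℕ<n r)))

  private
    lin48,21 : lin 48 21 ≡ lin 24 10 ℕ.+ h
    lin48,21 = lemma k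
      where
      lemma : ∀ k → 48 ℕ.* k ℕ.+ 21 ≡ (24 ℕ.* k ℕ.+ 10) ℕ.+ (24 ℕ.* k ℕ.+ 11)
      lemma = ℕ-Ring.solve-∀

  opposite-of-high : ∀ r → h ≤ toℕ r → toℕ (opposite r) < h
  opposite-of-high r h≤r = ℕ.≤-<-trans (ℕ.+-cancelʳ-≤ h (toℕ (opposite r)) (lin 24 10)
    (subst (toℕ (opposite r) ℕ.+ h ≤_) (trans (opposite-sum r) lin48,21) (ℕ.+-monoʳ-≤ (toℕ (opposite r)) h≤r))) (lin<h 24 10)

  opposite-of-low : ∀ r → toℕ r < h → h ≤ toℕ (opposite r)
  opposite-of-low r r<h = ℕ.≮⇒≥ λ opp<h → ℕ.<⇒≱ (lin-< 48 48 20 21)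
    (subst (ℕ._≤ lin 48 20) (opposite-sum r) (sum-≤ (lin-pred opp<h) (lin-pred r<h) (lemma k)))
    where
    lin-pred : ∀ {x} → x < h → x ≤ lin 24 10
    lin-pred {x} x<h = ℕ.≤-pred (subst (suc x ≤_) (ℕ.+-suc (24 ℕ.* k) 10) x<h)
    lemma : ∀ k → (24 ℕ.* k ℕ.+ 10) ℕ.+ (24 ℕ.* k ℕ.+ 10) ≡ 48 ℕ.* k ℕ.+ 20
    lemma = ℕ-Ring.solve-∀

  +h : + h ≡ 𝐡
  +h = +lin 24 11

  𝐡≢0 : ¬ 𝐡 ≡ 0ℤ [mod 𝐧 ]
  𝐡≢0 𝐡≡0 with congruent⇒≡ h<n (ℕ.≤-<-trans z≤n h<n) (subst₂ (λ a m → a ≡ + 0 [mod m ]) (sym +h) (sym +n) 𝐡≡0)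
  ... | h≡0 with ℕ.m+n≡0⇒n≡0 (24 ℕ.* k) h≡0
  ... | ()

  𝐡≡0[mod𝐡] : 𝐡 ≡ 0ℤ [mod 𝐡 ]
  𝐡≡0[mod𝐡] = congruent (divides (+ 1) (lemma 𝐡))
    where
    lemma : ∀ x → x - + 0 ≡ + 1 * x
    lemma = solve-∀

  -𝐡≡𝐡 : 0ℤ - 𝐡 ≡ 𝐡 [mod 𝐧 ]
  -𝐡≡𝐡 = congruent (divides (- + 1) (lemma κ))
    where
    lemma : ∀ x → (+ 0 - (+ 24 * x + + 11)) - (+ 24 * x + + 11) ≡ - + 1 * (+ 48 * x + + 22)
    lemma = solve-∀

  opposite-congruent : ∀ r → + toℕ (opposite r) ≡ - + 1 - + toℕ r [mod 𝐧 ]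
  opposite-congruent r = by-identity identity (divides (+ 1) refl)
    where
    identity : + 1 * 𝐧 ≡ + toℕ (opposite r) - (- + 1 - + toℕ r)
    identity = begin
      + 1 * 𝐧                                         ≡⟨ lemma₁ κ ⟩
      (+ 48 * κ + + 21) + + 1                          ≡⟨ cong (_+ + 1) (+lin 48 21) ⟨
      + lin 48 21 + + 1                                ≡⟨ cong (λ x → + x + + 1) (opposite-sum r) ⟨
      + (toℕ (opposite r) ℕ.+ toℕ r) + + 1             ≡⟨ cong (_+ + 1) (pos-+ (toℕ (opposite r)) (toℕ r)) ⟩
      (+ toℕ (opposite r) + + toℕ r) + + 1             ≡⟨ lemma₂ (+ toℕ (opposite r)) (+ toℕ r) ⟩
      + toℕ (opposite r) - (- + 1 - + toℕ r)           ∎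
      where
      open ≡-Reasoning
      lemma₁ : ∀ x → + 1 * (+ 48 * x + + 22) ≡ (+ 48 * x + + 21) + + 1
      lemma₁ = solve-∀
      lemma₂ : ∀ o r → (o + r) + + 1 ≡ o - (- + 1 - r)
      lemma₂ = solve-∀

  infix 5 _κ+_

  record Linear : Set where
    constructor _κ+_
    field
      slope intercept : ℤ

  ⟦_⟧ : Linear → ℤ
  ⟦ a κ+ b ⟧ = a * κ + b

  _⊟_ : Linear → Linear → Linear
  (a κ+ b) ⊟ (c κ+ d) = (a - c) κ+ (b - d)

  ⟦⊟⟧ : ∀ x y → ⟦ x ⊟ y ⟧ ≡ ⟦ x ⟧ - ⟦ y ⟧
  ⟦⊟⟧ (a κ+ b) (c κ+ d) = lemma a b c d κ
    where
    lemma : ∀ a b c d x → (a - c) * x + (b - d) ≡ (a * x + b) - (c * x + d)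
    lemma = solve-∀

  -- F follows ⟨ A , B , S , e ⟩ when F(2i) ≡ A + iS and F(2i+1) ≡ B + iS on the rows below h
  -- and F(n-1-r) ≡ e - F(r).
  record Pattern : Set where
    constructor ⟨_,_,_,_⟩
    field
      A B S e : Linear

  value : Pattern → ∀ {x} → Low x → ℤ
  value P (even i _ _) = ⟦ Pattern.A P ⟧ + + i * ⟦ Pattern.S P ⟧
  value P (odd i _ _)  = ⟦ Pattern.B P ⟧ + + i * ⟦ Pattern.S P ⟧

  record Follows (F : Fin n → ℤ) (P : Pattern) : Set where
    field
      on-low      : ∀ r (ℓ : Low (toℕ r)) → F r ≡ value P ℓ [mod 𝐧 ]
      on-opposite : ∀ r → toℕ r < h → F (opposite r) ≡ ⟦ Pattern.e P ⟧ - F r [mod 𝐧 ]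

  toℕ-mod𝐧 : ∀ a → + toℕ (a mod n) ≡ + a [mod 𝐧 ]
  toℕ-mod𝐧 a = subst (λ m → + toℕ (a mod n) ≡ + a [mod m ]) +n (toℕ-mod n a)

  minus-one zero-linear : Linear
  minus-one = + 0 κ+ - + 1
  zero-linear = + 0 κ+ + 0

  _⊟ᵖ_ : Pattern → Pattern → Pattern
  ⟨ A₂ , B₂ , S₂ , _ ⟩ ⊟ᵖ ⟨ A₁ , B₁ , S₁ , _ ⟩ = ⟨ A₂ ⊟ A₁ , B₂ ⊟ B₁ , S₂ ⊟ S₁ , zero-linear ⟩

  value-⊟ᵖ : ∀ P₂ P₁ {x} (ℓ : Low x) → value (P₂ ⊟ᵖ P₁) ℓ ≡ value P₂ ℓ - value P₁ ℓ
  value-⊟ᵖ ⟨ A₂ , B₂ , S₂ , _ ⟩ ⟨ A₁ , B₁ , S₁ , _ ⟩ (even i _ _) =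
    trans (cong₂ (λ a s → a + + i * s) (⟦⊟⟧ A₂ A₁) (⟦⊟⟧ S₂ S₁)) (lemma ⟦ A₂ ⟧ ⟦ A₁ ⟧ ⟦ S₂ ⟧ ⟦ S₁ ⟧ (+ i))
    where
    lemma : ∀ a₂ a₁ s₂ s₁ i → (a₂ - a₁) + i * (s₂ - s₁) ≡ (a₂ + i * s₂) - (a₁ + i * s₁)
    lemma = solve-∀
  value-⊟ᵖ ⟨ A₂ , B₂ , S₂ , _ ⟩ ⟨ A₁ , B₁ , S₁ , _ ⟩ (odd i _ _) =
    trans (cong₂ (λ b s → b + + i * s) (⟦⊟⟧ B₂ B₁) (⟦⊟⟧ S₂ S₁)) (lemma ⟦ B₂ ⟧ ⟦ B₁ ⟧ ⟦ S₂ ⟧ ⟦ S₁ ⟧ (+ i))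
    where
    lemma : ∀ b₂ b₁ s₂ s₁ i → (b₂ - b₁) + i * (s₂ - s₁) ≡ (b₂ + i * s₂) - (b₁ + i * s₁)
    lemma = solve-∀

  difference-follows : ∀ {A₁ B₁ S₁ A₂ B₂ S₂ e} ca cb →
    Follows (λ r → + toℕ (ca r)) ⟨ A₁ , B₁ , S₁ , e ⟩ → Follows (λ r → + toℕ (cb r)) ⟨ A₂ , B₂ , S₂ , e ⟩ →
    Follows (difference n ca cb) (⟨ A₂ , B₂ , S₂ , e ⟩ ⊟ᵖ ⟨ A₁ , B₁ , S₁ , e ⟩)
  difference-follows {A₁} {B₁} {S₁} {A₂} {B₂} {S₂} {e} ca cb a-follows b-follows = record
    { on-low = λ r ℓ → mod-trans (mod-+ (on-low b-follows r ℓ) (mod-neg (on-low a-follows r ℓ)))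
                                  (≡⇒mod (sym (value-⊟ᵖ ⟨ A₂ , B₂ , S₂ , e ⟩ ⟨ A₁ , B₁ , S₁ , e ⟩ ℓ)))
    ; on-opposite = λ r r<h → mod-trans (mod-+ (on-opposite b-follows r r<h) (mod-neg (on-opposite a-follows r r<h)))
                                         (≡⇒mod (lemma ⟦ e ⟧ (+ toℕ (cb r)) (+ toℕ (ca r)) κ))
    }
    where
    open Follows
    lemma : ∀ e b a x → (e - b) - (e - a) ≡ (+ 0 * x + + 0) - (b - a)
    lemma = solve-∀

  c₁-follows : Follows (λ r → + toℕ (c₁ k r)) ⟨ + 0 κ+ + 0 , + 0 κ+ + 1 , + 0 κ+ + 2 , minus-one ⟩
  c₁-follows = record { on-low = on-low ; on-opposite = λ r _ → opposite-congruent r }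
    where
    on-low : ∀ r (ℓ : Low (toℕ r)) → + toℕ r ≡ value ⟨ + 0 κ+ + 0 , + 0 κ+ + 1 , + 0 κ+ + 2 , minus-one ⟩ ℓ [mod 𝐧 ]
    on-low r (even i _ r≡2i) = ≡⇒mod (trans (cong +_ r≡2i) (trans (pos-+ i i) (lemma (+ i) κ)))
      where
      lemma : ∀ i x → i + i ≡ (+ 0 * x + + 0) + i * (+ 0 * x + + 2)
      lemma = solve-∀
    on-low r (odd i _ r≡2i+1) = ≡⇒mod (trans (cong +_ r≡2i+1) (trans (pos-+ 1 (i ℕ.+ i)) (trans (cong (λ z → + 1 + z) (pos-+ i i)) (lemma (+ i) κ))))
      where
      lemma : ∀ i x → + 1 + (i + i) ≡ (+ 0 * x + + 1) + i * (+ 0 * x + + 2)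
      lemma = solve-∀

  extend-below : ∀ low r → toℕ r < h → extend k low r ≡ low k (toℕ r) mod n
  extend-below low r r<h with toℕ r ℕ.<? ord k / 2
  ... | yes _ = refl
  ... | no r≮n/2 = contradiction (subst (toℕ r <_) (sym n/2≡h) r<h) r≮n/2

  extend-opposite : ∀ low r → toℕ r < h → extend k low (opposite r) ≡ (lin 48 21 ℕ.∸ toℕ (low k (toℕ r) mod n)) mod n
  extend-opposite low r r<h with toℕ (opposite r) ℕ.<? ord k / 2
  ... | yes o<n/2 = contradiction (subst (toℕ (opposite r) <_) n/2≡h o<n/2) (ℕ.≤⇒≯ (opposite-of-low r r<h))
  ... | no _ = cong (λ x → (lin 48 21 ℕ.∸ toℕ (low k x mod n)) mod n)
                    (trans (cong (ℕ._∸ toℕ (opposite r)) (sym (opposite-sum r))) (ℕ.m+n∸m≡n (toℕ (opposite r)) (toℕ r)))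

  extend-follows : ∀ {low A B S} →
    (∀ i → + low k (i ℕ.+ i) ≡ ⟦ A ⟧ + + i * ⟦ S ⟧) → (∀ i → + low k (suc (i ℕ.+ i)) ≡ ⟦ B ⟧ + + i * ⟦ S ⟧) →
    Follows (λ r → + toℕ (extend k low r)) ⟨ A , B , S , minus-one ⟩
  extend-follows {low} even-rows odd-rows = record { on-low = on-low ; on-opposite = on-opposite }
    where
    open SetoidReasoning (mod-setoid 𝐧)
    below : ∀ r → toℕ r < h → + toℕ (extend k low r) ≡ + low k (toℕ r) [mod 𝐧 ]
    below r r<h = subst (λ f → + toℕ f ≡ + low k (toℕ r) [mod 𝐧 ]) (sym (extend-below low r r<h)) (toℕ-mod𝐧 _)
    on-low : ∀ r (ℓ : Low (toℕ r)) → _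
    on-low r ℓ@(even i _ r≡2i) = mod-trans (below r (Low⇒<h ℓ)) (≡⇒mod (trans (cong (λ x → + low k x) r≡2i) (even-rows i)))
    on-low r ℓ@(odd i _ r≡2i+1) = mod-trans (below r (Low⇒<h ℓ)) (≡⇒mod (trans (cong (λ x → + low k x) r≡2i+1) (odd-rows i)))
    on-opposite : ∀ r → toℕ r < h → _
    on-opposite r r<h = begin
      + toℕ (extend k low (opposite r))     ≡⟨ cong (+_ ∘ toℕ) (extend-opposite low r r<h) ⟩
      + toℕ ((lin 48 21 ℕ.∸ t) mod n)       ≈⟨ toℕ-mod𝐧 _ ⟩
      + (lin 48 21 ℕ.∸ t)                   ≡⟨ trans (m-n≡m⊖n (lin 48 21) t) (⊖-≥ t≤) ⟨
      + lin 48 21 - + t                     ≈⟨ mod-+ n-1≡-1 (mod-refl {a = - + t}) ⟩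
      - + 1 - + t                           ≡⟨ cong (λ f → - + 1 - + toℕ f) (extend-below low r r<h) ⟨
      - + 1 - + toℕ (extend k low r)        ∎
      where
      t = toℕ (low k (toℕ r) mod n)
      t≤ : t ≤ lin 48 21
      t≤ = ℕ.≤-pred (toℕ<n (low k (toℕ r) mod n))
      n-1≡-1 : + lin 48 21 ≡ - + 1 [mod 𝐧 ]
      n-1≡-1 = subst (λ x → x ≡ - + 1 [mod 𝐧 ]) (sym (+lin 48 21)) (congruent (divides (+ 1) (lemma κ)))
        where
        lemma : ∀ x → (+ 48 * x + + 21) - - + 1 ≡ + 1 * (+ 48 * x + + 22)
        lemma = solve-∀

  parity-branch : ℕ → ℕ → ℕ → ℕ
  parity-branch zero    x _ = x
  parity-branch (suc _) _ y = y

  even-branch : ∀ i (f g : ℕ → ℕ) → parity-branch ((i ℕ.+ i) % 2) (f ((i ℕ.+ i) / 2)) (g ((i ℕ.+ i) / 2)) ≡ f i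
  even-branch i f g rewrite proj₁ (halve-even i) | proj₂ (halve-even i) = refl

  odd-branch : ∀ i (f g : ℕ → ℕ) → parity-branch (suc (i ℕ.+ i) % 2) (f (suc (i ℕ.+ i) / 2)) (g (suc (i ℕ.+ i) / 2)) ≡ g i
  odd-branch i f g rewrite proj₁ (halve-odd i) | proj₂ (halve-odd i) = refl

  +affine : ∀ a b c d i → + (lin a b ℕ.+ i ℕ.* lin c d) ≡ ⟦ + a κ+ + b ⟧ + + i * ⟦ + c κ+ + d ⟧
  +affine a b c d i = trans (pos-+ (lin a b) (i ℕ.* lin c d))
    (cong₂ _+_ (+lin a b) (trans (pos-* i (lin c d)) (cong (+ i *_) (+lin c d))))

  P₁ P₂ P₃ : Pattern
  P₁ = ⟨ + 0 κ+ + 0 , + 0 κ+ + 1 , + 0 κ+ + 2 , minus-one ⟩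
  P₂ = ⟨ + 30 κ+ + 13 , + 12 κ+ + 5 , + 12 κ+ + 6 , minus-one ⟩
  P₃ = ⟨ + 30 κ+ + 14 , + 24 κ+ + 12 , + 12 κ+ + 7 , minus-one ⟩

  c₂-split : ∀ r → c₂-low k r ≡ parity-branch (r % 2) (lin 30 13 ℕ.+ (r / 2) ℕ.* lin 12 6) (lin 12 5 ℕ.+ (r / 2) ℕ.* lin 12 6)
  c₂-split r with r % 2
  ... | zero  = refl
  ... | suc _ = refl

  c₃-split : ∀ r → c₃-low k r ≡ parity-branch (r % 2) (lin 30 14 ℕ.+ (r / 2) ℕ.* lin 12 7) (lin 24 12 ℕ.+ (r / 2) ℕ.* lin 12 7)
  c₃-split r with r % 2
  ... | zero  = refl
  ... | suc _ = refl

  c₂-follows : Follows (λ r → + toℕ (c₂ k r)) P₂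
  c₂-follows = extend-follows
    (λ i → trans (cong +_ (trans (c₂-split (i ℕ.+ i)) (even-branch i f g))) (+affine 30 13 12 6 i))
    (λ i → trans (cong +_ (trans (c₂-split (suc (i ℕ.+ i))) (odd-branch i f g))) (+affine 12 5 12 6 i))
    where
    f g : ℕ → ℕ
    f q = lin 30 13 ℕ.+ q ℕ.* lin 12 6
    g q = lin 12 5 ℕ.+ q ℕ.* lin 12 6

  c₃-follows : Follows (λ r → + toℕ (c₃ k r)) P₃
  c₃-follows = extend-follows
    (λ i → trans (cong +_ (trans (c₃-split (i ℕ.+ i)) (even-branch i f g))) (+affine 30 14 12 7 i))
    (λ i → trans (cong +_ (trans (c₃-split (suc (i ℕ.+ i))) (odd-branch i f g))) (+affine 24 12 12 7 i))
    where
    f g : ℕ → ℕ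
    f q = lin 30 14 ℕ.+ q ℕ.* lin 12 7
    g q = lin 24 12 ℕ.+ q ℕ.* lin 12 7

  module Roots (S T : ℤ) (unit : T * S ≡ + 1 [mod 𝐡 ]) where

    record NoRootUpTo (X : ℤ) (c d : ℕ) : Set where
      constructor no-root
      field
        not-root : ∀ u → u ≤ lin c d → ¬ X + + u * S ≡ 0ℤ [mod 𝐧 ]

    open NoRootUpTo public

    step-injective : ∀ {u w} → u < h → w < h → + u * S ≡ + w * S [mod 𝐡 ] → u ≡ w
    step-injective {u} {w} u<h w<h uS≡wS =
      congruent⇒≡ u<h w<h (subst (λ m → + u ≡ + w [mod m ]) (sym +h) (mod-cancel-unit {t = T} unit uS≡wS))

    root-forced : ∀ {X u} a b {a≤24 : True (a ℕ.≤? 24)} {b<11 : True (suc b ℕ.≤? 11)} →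
                  X + (+ a * κ + + b) * S ≡ 0ℤ [mod 𝐡 ] → u < h → X + + u * S ≡ 0ℤ [mod 𝐧 ] → u ≡ lin a b
    root-forced {X} a b {a≤24} {b<11} w-root u<h u-root = step-injective u<h (lin<h a b {a≤24} {b<11}) (mod-+-cancelˡ {c = X}
      (mod-trans (mod-divisor 𝐡∣𝐧 u-root) (mod-sym (subst (λ w → X + w * S ≡ 0ℤ [mod 𝐡 ]) (sym (+lin a b)) w-root))))

    no-root-above : ∀ {X c d} a b {a≤24 : True (a ℕ.≤? 24)} {b<11 : True (suc b ℕ.≤? 11)}
                    {c≤a : True (c ℕ.≤? a)} {d<b : True (suc d ℕ.≤? b)} →
                    X + (+ a * κ + + b) * S ≡ 0ℤ [mod 𝐡 ] → NoRootUpTo X c d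
    no-root-above {X} {c} {d} a b {a≤24} {b<11} {c≤a} {d<b} w-root = no-root λ u u≤U u-root → ℕ.<⇒≱ U<w
      (subst (ℕ._≤ lin c d) (root-forced {X} a b {a≤24} {b<11} w-root (ℕ.<-trans (ℕ.≤-<-trans u≤U U<w) (lin<h a b {a≤24} {b<11})) u-root) u≤U)
      where
      U<w = lin-< c a d b {c≤a} {d<b}

    -- The only candidate root modulo h leaves the residue h modulo n.
    no-root-half : ∀ {X c d} a b {a≤24 : True (a ℕ.≤? 24)} {b<11 : True (suc b ℕ.≤? 11)}
                   {c≤24 : True (c ℕ.≤? 24)} {d<11 : True (suc d ℕ.≤? 11)} →
                   X + (+ a * κ + + b) * S ≡ 𝐡 [mod 𝐧 ] → NoRootUpTo X c d
    no-root-half {X} {c} {d} a b {a≤24} {b<11} {c≤24} {d<11} w≡𝐡 = no-root λ u u≤U u-root → 𝐡≢0 (mod-trans (mod-sym w≡𝐡) (w-root u u≤U u-root))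
      where
      w-root : ∀ u → u ≤ lin c d → X + + u * S ≡ 0ℤ [mod 𝐧 ] → X + (+ a * κ + + b) * S ≡ 0ℤ [mod 𝐧 ]
      w-root u u≤U u-root = subst (λ w → X + w * S ≡ 0ℤ [mod 𝐧 ]) (trans (cong +_ u≡w) (+lin a b)) u-root
        where
        u≡w = root-forced {X} a b {a≤24} {b<11} (mod-trans (mod-divisor 𝐡∣𝐧 w≡𝐡) 𝐡≡0[mod𝐡])
                (ℕ.≤-<-trans u≤U (lin<h c d {c≤24} {d<11})) u-root

  ≤maxE⇒<h : ∀ {i} → i ≤ maxE → i < h
  ≤maxE⇒<h i≤maxE = ℕ.≤-<-trans i≤maxE (lin<h 12 5)

  ≤maxO⇒<h : ∀ {i} → i ≤ maxO → i < h
  ≤maxO⇒<h i≤maxO = ℕ.≤-<-trans i≤maxO (lin<h 12 4)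

  evens<h : ∀ {i i′} → i ≤ maxE → i′ ≤ maxE → i ℕ.+ i′ < h
  evens<h i≤maxE i′≤maxE = ℕ.≤-<-trans (sum-≤ i≤maxE i′≤maxE maxE+maxE) (lin<h 24 10)

  odds<h : ∀ {i i′} → i ≤ maxO → i′ ≤ maxO → i ℕ.+ i′ < h
  odds<h i≤maxO i′≤maxO = ℕ.≤-<-trans (sum-≤ i≤maxO i′≤maxO maxO+maxO) (lin<h 24 8)

  module PatternFacts (P : Pattern) (T : ℤ) (unit : T * ⟦ Pattern.S P ⟧ ≡ + 1 [mod 𝐡 ]) where

    open Pattern P
    open Roots ⟦ S ⟧ T unit public

    record EvenCross (Q : ℕ → Set) : Set where
      constructor even-cross
      field
        even-cross-root : ∀ {i i′} → i ≤ maxE → i′ ≤ maxE →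
                          (⟦ A ⟧ + ⟦ A ⟧ - ⟦ e ⟧) + + (i ℕ.+ i′) * ⟦ S ⟧ ≡ 0ℤ [mod 𝐧 ] → Q (i′ ℕ.+ i′)

    record OddCross (Q : ℕ → Set) : Set where
      constructor odd-cross
      field
        odd-cross-root : ∀ {i i′} → i ≤ maxO → i′ ≤ maxO →
                         (⟦ B ⟧ + ⟦ B ⟧ - ⟦ e ⟧) + + (i ℕ.+ i′) * ⟦ S ⟧ ≡ 0ℤ [mod 𝐧 ] → Q (suc (i′ ℕ.+ i′))

    open EvenCross
    open OddCross

    -- Q y marks the low rows y whose mirror image n-1-y may share its F-value with another row.
    record Separation (Q : ℕ → Set) : Set where
      field
        even-odd   : NoRootUpTo (⟦ A ⟧ - ⟦ B ⟧ - (+ 12 * κ + + 4) * ⟦ S ⟧) 24 9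
        even-odd′  : NoRootUpTo (⟦ A ⟧ + ⟦ B ⟧ - ⟦ e ⟧) 24 9
        even-even′ : EvenCross Q
        odd-odd′   : OddCross Q

    even-cross-none : ∀ {Q} → NoRootUpTo (⟦ A ⟧ + ⟦ A ⟧ - ⟦ e ⟧) 24 10 → EvenCross Q
    even-cross-none none = even-cross λ i≤maxE i′≤maxE root → ⊥-elim (not-root none _ (sum-≤ i≤maxE i′≤maxE maxE+maxE) root)

    odd-cross-none : ∀ {Q} → NoRootUpTo (⟦ B ⟧ + ⟦ B ⟧ - ⟦ e ⟧) 24 8 → OddCross Q
    odd-cross-none none = odd-cross λ i≤maxO i′≤maxO root → ⊥-elim (not-root none _ (sum-≤ i≤maxO i′≤maxO maxO+maxO) root)

    private
      both-maximal : ∀ {i i′ M} → i ≤ M → i′ ≤ M → i ℕ.+ i′ ≡ M ℕ.+ M → i′ ≡ M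
      both-maximal {i} {i′} {M} i≤M i′≤M i+i′≡M+M = ℕ.≤-antisym i′≤M
        (ℕ.+-cancelˡ-≤ M M i′ (subst (ℕ._≤ M ℕ.+ i′) i+i′≡M+M (ℕ.+-monoˡ-≤ i′ i≤M)))

    even-cross-top : (⟦ A ⟧ + ⟦ A ⟧ - ⟦ e ⟧) + (+ 24 * κ + + 10) * ⟦ S ⟧ ≡ 0ℤ [mod 𝐡 ] →
                     EvenCross (_≡ maxE ℕ.+ maxE)
    even-cross-top root = even-cross λ i≤maxE i′≤maxE u-root → cong (λ j → j ℕ.+ j) (both-maximal i≤maxE i′≤maxE
      (trans (root-forced {⟦ A ⟧ + ⟦ A ⟧ - ⟦ e ⟧} 24 10 root (evens<h i≤maxE i′≤maxE) u-root) (sym maxE+maxE)))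

    odd-cross-top : (⟦ B ⟧ + ⟦ B ⟧ - ⟦ e ⟧) + (+ 24 * κ + + 8) * ⟦ S ⟧ ≡ 0ℤ [mod 𝐡 ] →
                    OddCross (_≡ suc (maxO ℕ.+ maxO))
    odd-cross-top root = odd-cross λ i≤maxO i′≤maxO u-root → cong (λ j → suc (j ℕ.+ j)) (both-maximal i≤maxO i′≤maxO
      (trans (root-forced {⟦ B ⟧ + ⟦ B ⟧ - ⟦ e ⟧} 24 8 root (odds<h i≤maxO i′≤maxO) u-root) (sym maxO+maxO)))

    odd-cross-bottom : (⟦ B ⟧ + ⟦ B ⟧ - ⟦ e ⟧) + (+ 0 * κ + + 0) * ⟦ S ⟧ ≡ 0ℤ [mod 𝐡 ] → OddCross (_≡ 1)
    odd-cross-bottom root = odd-cross λ {i} i≤maxO i′≤maxO u-root →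
      cong (λ j → suc (j ℕ.+ j)) (ℕ.m+n≡0⇒n≡0 i (root-forced {⟦ B ⟧ + ⟦ B ⟧ - ⟦ e ⟧} 0 0 root (odds<h i≤maxO i′≤maxO) u-root))

    even≢odd : NoRootUpTo (⟦ A ⟧ - ⟦ B ⟧ - (+ 12 * κ + + 4) * ⟦ S ⟧) 24 9 → ∀ {i i′} → i ≤ maxE → i′ ≤ maxO →
               ¬ ⟦ A ⟧ + + i * ⟦ S ⟧ ≡ ⟦ B ⟧ + + i′ * ⟦ S ⟧ [mod 𝐧 ]
    even≢odd none {i} {i′} i≤maxE i′≤maxO eq =
      not-root none (i ℕ.+ a′) (sum-≤ i≤maxE (ℕ.m∸n≤m maxO i′) maxE+maxO) (by-identity identity (difference-divisible eq))
      where
      open ≡-Reasoning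
      -- with i′ + a′ = maxO the difference of the two values is X + (i + a′) S
      a′ = maxO ℕ.∸ i′
      maxO≡ : + 12 * κ + + 4 ≡ + i′ + + a′
      maxO≡ = trans (sym (+lin 12 4)) (trans (cong +_ (sym (ℕ.m+[n∸m]≡n i′≤maxO))) (pos-+ i′ a′))
      lemma : ∀ A B S i i′ a′ → (A + i * S) - (B + i′ * S) ≡ (A - B - (i′ + a′) * S) + (i + a′) * S - + 0
      lemma = solve-∀
      identity : (⟦ A ⟧ + + i * ⟦ S ⟧) - (⟦ B ⟧ + + i′ * ⟦ S ⟧) ≡
                 (⟦ A ⟧ - ⟦ B ⟧ - (+ 12 * κ + + 4) * ⟦ S ⟧) + + (i ℕ.+ a′) * ⟦ S ⟧ - 0ℤ
      identity = begin
        (⟦ A ⟧ + + i * ⟦ S ⟧) - (⟦ B ⟧ + + i′ * ⟦ S ⟧)                       ≡⟨ lemma ⟦ A ⟧ ⟦ B ⟧ ⟦ S ⟧ (+ i) (+ i′) (+ a′) ⟩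
        (⟦ A ⟧ - ⟦ B ⟧ - (+ i′ + + a′) * ⟦ S ⟧) + (+ i + + a′) * ⟦ S ⟧ - 0ℤ  ≡⟨ cong₂ (λ m u → (⟦ A ⟧ - ⟦ B ⟧ - m * ⟦ S ⟧) + u * ⟦ S ⟧ - 0ℤ)
                                                                                     (sym maxO≡) (sym (pos-+ i a′)) ⟩
        (⟦ A ⟧ - ⟦ B ⟧ - (+ 12 * κ + + 4) * ⟦ S ⟧) + + (i ℕ.+ a′) * ⟦ S ⟧ - 0ℤ ∎

    low-injective : NoRootUpTo (⟦ A ⟧ - ⟦ B ⟧ - (+ 12 * κ + + 4) * ⟦ S ⟧) 24 9 →
                    ∀ {x y} (ℓ : Low x) (ℓ′ : Low y) → value P ℓ ≡ value P ℓ′ [mod 𝐧 ] → x ≡ y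
    low-injective _ (even i i≤maxE refl) (even i′ i′≤maxE refl) eq = cong (λ j → j ℕ.+ j)
      (step-injective (≤maxE⇒<h i≤maxE) (≤maxE⇒<h i′≤maxE) (mod-divisor 𝐡∣𝐧 (mod-+-cancelˡ {c = ⟦ A ⟧} eq)))
    low-injective _ (odd i i≤maxO refl) (odd i′ i′≤maxO refl) eq = cong (λ j → suc (j ℕ.+ j))
      (step-injective (≤maxO⇒<h i≤maxO) (≤maxO⇒<h i′≤maxO) (mod-divisor 𝐡∣𝐧 (mod-+-cancelˡ {c = ⟦ B ⟧} eq)))
    low-injective none (even _ i≤maxE _) (odd _ i′≤maxO _) eq = ⊥-elim (even≢odd none i≤maxE i′≤maxO eq)
    low-injective none (odd _ i≤maxO _) (even _ i′≤maxE _) eq = ⊥-elim (even≢odd none i′≤maxE i≤maxO (mod-sym eq))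

    private
      regroup : ∀ C D i i′ → ((C + + i * ⟦ S ⟧) + (D + + i′ * ⟦ S ⟧)) - ⟦ e ⟧ ≡
                            (C + D - ⟦ e ⟧) + + (i ℕ.+ i′) * ⟦ S ⟧ - 0ℤ
      regroup C D i i′ = trans (lemma C D ⟦ e ⟧ ⟦ S ⟧ (+ i) (+ i′))
                               (cong (λ u → (C + D - ⟦ e ⟧) + u * ⟦ S ⟧ - 0ℤ) (sym (pos-+ i i′)))
        where
        lemma : ∀ C D e S i i′ → ((C + i * S) + (D + i′ * S)) - e ≡ (C + D - e) + (i + i′) * S - + 0
        lemma = solve-∀

    low-cross : ∀ {Q} → Separation Q → ∀ {x y} (ℓ : Low x) (ℓ′ : Low y) →
                value P ℓ + value P ℓ′ ≡ ⟦ e ⟧ [mod 𝐧 ] → Q y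
    low-cross sep (even i i≤maxE _) (even i′ i′≤maxE refl) eq =
      even-cross-root (Separation.even-even′ sep) i≤maxE i′≤maxE (by-identity (regroup ⟦ A ⟧ ⟦ A ⟧ i i′) (difference-divisible eq))
    low-cross sep (odd i i≤maxO _) (odd i′ i′≤maxO refl) eq =
      odd-cross-root (Separation.odd-odd′ sep) i≤maxO i′≤maxO (by-identity (regroup ⟦ B ⟧ ⟦ B ⟧ i i′) (difference-divisible eq))
    low-cross sep (even i i≤maxE _) (odd i′ i′≤maxO _) eq = ⊥-elim (not-root (Separation.even-odd′ sep) (i ℕ.+ i′)
      (sum-≤ i≤maxE i′≤maxO maxE+maxO) (by-identity (regroup ⟦ A ⟧ ⟦ B ⟧ i i′) (difference-divisible eq)))
    low-cross sep (odd i i≤maxO _) (even i′ i′≤maxE _) eq = ⊥-elim (not-root (Separation.even-odd′ sep) (i′ ℕ.+ i)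
      (sum-≤ i′≤maxE i≤maxO maxE+maxO) (by-identity (regroup ⟦ A ⟧ ⟦ B ⟧ i′ i)
        (difference-divisible (mod-trans (≡⇒mod (ℤ+-comm (⟦ A ⟧ + + i′ * ⟦ S ⟧) (⟦ B ⟧ + + i * ⟦ S ⟧))) eq))))

    low-nonzero : NoRootUpTo ⟦ A ⟧ 12 5 → NoRootUpTo ⟦ B ⟧ 12 4 → ∀ {x} (ℓ : Low x) → ¬ value P ℓ ≡ 0ℤ [mod 𝐧 ]
    low-nonzero none-A _ (even i i≤maxE _) = not-root none-A i i≤maxE
    low-nonzero _ none-B (odd i i≤maxO _) = not-root none-B i i≤maxO

    private
      side : ∀ r → toℕ r < h ⊎ toℕ (opposite r) < h
      side r with toℕ r ℕ.<? h
      ... | yes r<h = inj₁ r<h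
      ... | no r≮h = inj₂ (opposite-of-high r (ℕ.≮⇒≥ r≮h))

      opposite-injective : ∀ {r r′ : Fin n} → opposite r ≡ opposite r′ → r ≡ r′
      opposite-injective {r} {r′} eq = trans (sym (opposite-involutive r)) (trans (cong opposite eq) (opposite-involutive r′))

    module _ {F} (follows : Follows F P) where

      open Follows follows

      value-at : ∀ r {x} → toℕ r ≡ x → (ℓ : Low x) → F r ≡ value P ℓ [mod 𝐧 ]
      value-at r refl = on-low r

      high-value : ∀ {r} (opp<h : toℕ (opposite r) < h) → F r ≡ ⟦ e ⟧ - value P (<h⇒Low opp<h) [mod 𝐧 ]
      high-value {r} opp<h = begin
        F r                                      ≡⟨ cong F (opposite-involutive r) ⟨
        F (opposite (opposite r))                ≈⟨ on-opposite (opposite r) opp<h ⟩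
        ⟦ e ⟧ - F (opposite r)                   ≈⟨ mod-+ (mod-refl {a = ⟦ e ⟧}) (mod-neg (on-low (opposite r) (<h⇒Low opp<h))) ⟩
        ⟦ e ⟧ - value P (<h⇒Low opp<h)           ∎
        where
        open SetoidReasoning (mod-setoid 𝐧)

      separation-injective : ∀ {Q} → Separation Q → ∀ {r r′} → F r ≡ F r′ [mod 𝐧 ] →
                             r ≡ r′ ⊎ Q (toℕ (opposite r)) ⊎ Q (toℕ (opposite r′))
      separation-injective sep {r} {r′} eq with side r | side r′
      ... | inj₁ r<h | inj₁ r′<h = inj₁ (toℕ-injective (low-injective (Separation.even-odd sep) (<h⇒Low r<h) (<h⇒Low r′<h)
            (mod-trans (mod-sym (on-low r (<h⇒Low r<h))) (mod-trans eq (on-low r′ (<h⇒Low r′<h))))))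
      ... | inj₂ o<h | inj₂ o′<h = inj₁ (opposite-injective (toℕ-injective (low-injective (Separation.even-odd sep) (<h⇒Low o<h) (<h⇒Low o′<h)
            (mod-−-cancelˡ {c = ⟦ e ⟧} {value P (<h⇒Low o<h)} {value P (<h⇒Low o′<h)} (mod-trans (mod-sym (high-value o<h)) (mod-trans eq (high-value o′<h)))))))
      ... | inj₁ r<h | inj₂ o′<h = inj₂ (inj₂ (low-cross sep (<h⇒Low r<h) (<h⇒Low o′<h)
            (mod-−⇒+ (mod-trans (mod-sym (on-low r (<h⇒Low r<h))) (mod-trans eq (high-value o′<h))))))
      ... | inj₂ o<h | inj₁ r′<h = inj₂ (inj₁ (low-cross sep (<h⇒Low r′<h) (<h⇒Low o<h)
            (mod-−⇒+ (mod-trans (mod-sym (on-low r′ (<h⇒Low r′<h))) (mod-trans (mod-sym eq) (high-value o<h))))))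

      nonzero : ⟦ e ⟧ ≡ 0ℤ → NoRootUpTo ⟦ A ⟧ 12 5 → NoRootUpTo ⟦ B ⟧ 12 4 → ∀ r → ¬ F r ≡ 0ℤ [mod 𝐧 ]
      nonzero e≡0 none-A none-B r Fr≡0 with side r
      ... | inj₁ r<h = low-nonzero none-A none-B (<h⇒Low r<h) (mod-trans (mod-sym (on-low r (<h⇒Low r<h))) Fr≡0)
      ... | inj₂ o<h = low-nonzero none-A none-B (<h⇒Low o<h) (mod-−-cancelˡ {c = 0ℤ} {value P (<h⇒Low o<h)} {0ℤ}
            (subst (λ c → c - value P (<h⇒Low o<h) ≡ 0ℤ [mod 𝐧 ]) e≡0 (mod-trans (mod-sym (high-value o<h)) Fr≡0)))

    separation⇒injective : ∀ {c : Fin n → Fin n} → Follows (λ r → + toℕ (c r)) P → Separation (λ _ → ⊥) → Injective _≡_ _≡_ c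
    separation⇒injective follows sep {r} {r′} cr≡cr′ with separation-injective follows sep {r} {r′} (≡⇒mod (cong (+_ ∘ toℕ) cr≡cr′))
    ... | inj₁ r≡r′ = r≡r′
    ... | inj₂ (inj₁ ())
    ... | inj₂ (inj₂ ())

    even-value : ∀ a b (i≤maxE : lin a b ≤ maxE) → ⟦ A ⟧ + (+ a * κ + + b) * ⟦ S ⟧ ≡ 𝐡 [mod 𝐧 ] →
                 value P (even (lin a b) i≤maxE refl) ≡ 𝐡 [mod 𝐧 ]
    even-value a b _ = subst (λ w → ⟦ A ⟧ + w * ⟦ S ⟧ ≡ 𝐡 [mod 𝐧 ]) (sym (+lin a b))

    odd-value : ∀ a b (i≤maxO : lin a b ≤ maxO) → ⟦ B ⟧ + (+ a * κ + + b) * ⟦ S ⟧ ≡ 𝐡 [mod 𝐧 ] →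
                value P (odd (lin a b) i≤maxO refl) ≡ 𝐡 [mod 𝐧 ]
    odd-value a b _ = subst (λ w → ⟦ B ⟧ + w * ⟦ S ⟧ ≡ 𝐡 [mod 𝐧 ]) (sym (+lin a b))

    separation⇒nearlyOrthogonal : ∀ {ρ} ca cb → Follows (difference n ca cb) P → ⟦ e ⟧ ≡ 0ℤ →
      NoRootUpTo ⟦ A ⟧ 12 5 → NoRootUpTo ⟦ B ⟧ 12 4 → Separation (_≡ ρ) →
      (ℓρ : Low ρ) → value P ℓρ ≡ 𝐡 [mod 𝐧 ] → NearlyOrthogonal n (cyclic n ca) (cyclic n cb)
    separation⇒nearlyOrthogonal {ρ} ca cb follows e≡0 none-A none-B sep ℓρ value≡𝐡 =
      cyclic-nearlyOrthogonal n ca cb r₁ r₂ r₁≢r₂ (to-n (mod-trans d₁≡𝐡 𝐡≡half)) (to-n (mod-trans d₂≡𝐡 𝐡≡half))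
        (λ r → nonzero follows e≡0 none-A none-B r ∘ from-n)
        (⊎-map₂ (⊎-map at-r₂ at-r₂) ∘ separation-injective follows sep ∘ from-n)
      where
      to-n : ∀ {a b} → a ≡ b [mod 𝐧 ] → a ≡ b [mod + n ]
      to-n {a} {b} = subst (λ m → a ≡ b [mod m ]) (sym +n)
      from-n : ∀ {a b} → a ≡ b [mod + n ] → a ≡ b [mod 𝐧 ]
      from-n {a} {b} = subst (λ m → a ≡ b [mod m ]) +n
      𝐡≡half : 𝐡 ≡ + (n / 2) [mod 𝐧 ]
      𝐡≡half = ≡⇒mod (trans (sym +h) (cong +_ (sym n/2≡h)))
      ρ<h = Low⇒<h ℓρ
      r₁ r₂ : Fin n
      r₁ = fromℕ< (ℕ.<-trans ρ<h h<n)
      r₂ = opposite r₁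
      r₁≡ρ : toℕ r₁ ≡ ρ
      r₁≡ρ = toℕ-fromℕ< _
      r₁<h : toℕ r₁ < h
      r₁<h = subst (_< h) (sym r₁≡ρ) ρ<h
      r₁≢r₂ : r₁ ≢ r₂
      r₁≢r₂ r₁≡r₂ = ℕ.<⇒≱ r₁<h (subst (λ r → h ≤ toℕ r) (sym r₁≡r₂) (opposite-of-low r₁ r₁<h))
      d₁≡𝐡 : difference n ca cb r₁ ≡ 𝐡 [mod 𝐧 ]
      d₁≡𝐡 = mod-trans (value-at follows r₁ r₁≡ρ ℓρ) value≡𝐡
      d₂≡𝐡 : difference n ca cb r₂ ≡ 𝐡 [mod 𝐧 ]
      d₂≡𝐡 = mod-trans (Follows.on-opposite follows r₁ r₁<h)
        (subst (λ c → c - difference n ca cb r₁ ≡ 𝐡 [mod 𝐧 ]) (sym e≡0) (mod-trans (mod-+ (mod-refl {a = 0ℤ}) (mod-neg d₁≡𝐡)) -𝐡≡𝐡))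
      at-r₂ : ∀ {r} → toℕ (opposite r) ≡ ρ → r ≡ r₂
      at-r₂ {r} eq = trans (sym (opposite-involutive r)) (cong opposite (toℕ-injective (trans eq (sym r₁≡ρ))))

  -- For each family: an inverse of S modulo h and, for each kind of collision, the root w of X + wS
  -- modulo h together with its residue 0 or h modulo n; the quotients come from polynomial division.
  c₂-unit : ∀ x → (- + 48 * x + - + 20) * (+ 12 * x + + 6)
      ≡ + 1 [mod + 24 * x + + 11 ]
  c₂-unit x = congruent (divides (- + 24 * x + - + 11) (solve (x ∷ [])))

  c₂-even-odd : ∀ x → (+ 30 * x + + 13) - (+ 12 * x + + 5) - (+ 12 * x + + 4) * (+ 12 * x + + 6) + (+ 24 * x + + 10) * (+ 12 * x + + 6)
      ≡ 0ℤ [mod + 24 * x + + 11 ]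
  c₂-even-odd x = congruent (divides (+ 6 * x + + 4) (solve (x ∷ [])))

  c₂-even-odd′ : ∀ x → ((+ 30 * x + + 13) + (+ 12 * x + + 5) - (+ 0 * x + - + 1)) + (+ 12 * x + + 6) * (+ 12 * x + + 6)
      ≡ + 24 * x + + 11 [mod + 48 * x + + 22 ]
  c₂-even-odd′ x = congruent (divides (+ 3 * x + + 2) (solve (x ∷ [])))

  c₂-even-even′ : ∀ x → ((+ 30 * x + + 13) + (+ 30 * x + + 13) - (+ 0 * x + - + 1)) + (+ 0 * x + + 1) * (+ 12 * x + + 6)
      ≡ + 24 * x + + 11 [mod + 48 * x + + 22 ]
  c₂-even-even′ x = congruent (divides (+ 0 * x + + 1) (solve (x ∷ [])))

  c₂-odd-odd′ : ∀ x → ((+ 12 * x + + 5) + (+ 12 * x + + 5) - (+ 0 * x + - + 1)) + (+ 0 * x + + 0) * (+ 12 * x + + 6)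
      ≡ + 24 * x + + 11 [mod + 48 * x + + 22 ]
  c₂-odd-odd′ x = congruent (divides (+ 0 * x + + 0) (solve (x ∷ [])))

  module C₂ = PatternFacts P₂ (- + 48 * κ + - + 20) (c₂-unit κ)

  c₂-injective : Injective _≡_ _≡_ (c₂ k)
  c₂-injective = C₂.separation⇒injective c₂-follows record
    { even-odd   = C₂.no-root-above 24 10 (c₂-even-odd κ)
    ; even-odd′  = C₂.no-root-half 12 6 (c₂-even-odd′ κ)
    ; even-even′ = C₂.even-cross-none (C₂.no-root-half 0 1 (c₂-even-even′ κ))
    ; odd-odd′   = C₂.odd-cross-none (C₂.no-root-half 0 0 (c₂-odd-odd′ κ))
    }

  c₃-unit : ∀ x → (- + 56 * x + - + 25) * (+ 12 * x + + 7)
      ≡ + 1 [mod + 24 * x + + 11 ]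
  c₃-unit x = congruent (divides (- + 28 * x + - + 16) (solve (x ∷ [])))

  c₃-even-odd : ∀ x → (+ 30 * x + + 14) - (+ 24 * x + + 12) - (+ 12 * x + + 4) * (+ 12 * x + + 7) + (+ 24 * x + + 10) * (+ 12 * x + + 7)
      ≡ 0ℤ [mod + 24 * x + + 11 ]
  c₃-even-odd x = congruent (divides (+ 6 * x + + 4) (solve (x ∷ [])))

  c₃-even-odd′ : ∀ x → ((+ 30 * x + + 14) + (+ 24 * x + + 12) - (+ 0 * x + - + 1)) + (+ 12 * x + + 4) * (+ 12 * x + + 7)
      ≡ + 24 * x + + 11 [mod + 48 * x + + 22 ]
  c₃-even-odd′ x = congruent (divides (+ 3 * x + + 2) (solve (x ∷ [])))

  c₃-even-even′ : ∀ x → ((+ 30 * x + + 14) + (+ 30 * x + + 14) - (+ 0 * x + - + 1)) + (+ 24 * x + + 10) * (+ 12 * x + + 7)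
      ≡ + 24 * x + + 11 [mod + 48 * x + + 22 ]
  c₃-even-even′ x = congruent (divides (+ 6 * x + + 4) (solve (x ∷ [])))

  c₃-odd-odd′ : ∀ x → ((+ 24 * x + + 12) + (+ 24 * x + + 12) - (+ 0 * x + - + 1)) + (+ 24 * x + + 9) * (+ 12 * x + + 7)
      ≡ 0ℤ [mod + 24 * x + + 11 ]
  c₃-odd-odd′ x = congruent (divides (+ 12 * x + + 8) (solve (x ∷ [])))

  module C₃ = PatternFacts P₃ (- + 56 * κ + - + 25) (c₃-unit κ)

  c₃-injective : Injective _≡_ _≡_ (c₃ k)
  c₃-injective = C₃.separation⇒injective c₃-follows record
    { even-odd   = C₃.no-root-above 24 10 (c₃-even-odd κ)
    ; even-odd′  = C₃.no-root-half 12 4 (c₃-even-odd′ κ)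
    ; even-even′ = C₃.even-cross-none (C₃.no-root-half 24 10 (c₃-even-even′ κ))
    ; odd-odd′   = C₃.odd-cross-none (C₃.no-root-above 24 9 (c₃-odd-odd′ κ))
    }

  d₁₂-unit : ∀ x → (- + 40 * x + - + 19) * (+ 12 * x + + 4)
      ≡ + 1 [mod + 24 * x + + 11 ]
  d₁₂-unit x = congruent (divides (- + 20 * x + - + 7) (solve (x ∷ [])))

  d₁₂-even-odd : ∀ x → (+ 30 * x + + 13) - (+ 12 * x + + 4) - (+ 12 * x + + 4) * (+ 12 * x + + 4) + (+ 24 * x + + 10) * (+ 12 * x + + 4)
      ≡ 0ℤ [mod + 24 * x + + 11 ]
  d₁₂-even-odd x = congruent (divides (+ 6 * x + + 3) (solve (x ∷ [])))

  d₁₂-even-odd′ : ∀ x → ((+ 30 * x + + 13) + (+ 12 * x + + 4) - (+ 0 * x + + 0)) + (+ 12 * x + + 4) * (+ 12 * x + + 4)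
      ≡ + 24 * x + + 11 [mod + 48 * x + + 22 ]
  d₁₂-even-odd′ x = congruent (divides (+ 3 * x + + 1) (solve (x ∷ [])))

  d₁₂-even-even′ : ∀ x → ((+ 30 * x + + 13) + (+ 30 * x + + 13) - (+ 0 * x + + 0)) + (+ 24 * x + + 10) * (+ 12 * x + + 4)
      ≡ 0ℤ [mod + 24 * x + + 11 ]
  d₁₂-even-even′ x = congruent (divides (+ 12 * x + + 6) (solve (x ∷ [])))

  d₁₂-odd-odd′ : ∀ x → ((+ 12 * x + + 4) + (+ 12 * x + + 4) - (+ 0 * x + + 0)) + (+ 24 * x + + 9) * (+ 12 * x + + 4)
      ≡ 0ℤ [mod + 24 * x + + 11 ]
  d₁₂-odd-odd′ x = congruent (divides (+ 12 * x + + 4) (solve (x ∷ [])))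

  d₁₂-A : ∀ x → (+ 30 * x + + 13) + (+ 12 * x + + 5) * (+ 12 * x + + 4)
      ≡ + 24 * x + + 11 [mod + 48 * x + + 22 ]
  d₁₂-A x = congruent (divides (+ 3 * x + + 1) (solve (x ∷ [])))

  d₁₂-B : ∀ x → (+ 12 * x + + 4) + (+ 24 * x + + 10) * (+ 12 * x + + 4)
      ≡ 0ℤ [mod + 24 * x + + 11 ]
  d₁₂-B x = congruent (divides (+ 12 * x + + 4) (solve (x ∷ [])))

  module D₁₂ = PatternFacts (P₂ ⊟ᵖ P₁) (- + 40 * κ + - + 19) (d₁₂-unit κ)

  L₁-L₂-nearlyOrthogonal : NearlyOrthogonal n (L₁ k) (L₂ k)
  L₁-L₂-nearlyOrthogonal = D₁₂.separation⇒nearlyOrthogonal (c₁ k) (c₂ k) (difference-follows (c₁ k) (c₂ k) c₁-follows c₂-follows) refl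
    (D₁₂.no-root-half 12 5 (d₁₂-A κ)) (D₁₂.no-root-above 24 10 (d₁₂-B κ))
    record
      { even-odd   = D₁₂.no-root-above 24 10 (d₁₂-even-odd κ)
      ; even-odd′  = D₁₂.no-root-half 12 4 (d₁₂-even-odd′ κ)
      ; even-even′ = D₁₂.even-cross-top (d₁₂-even-even′ κ)
      ; odd-odd′   = D₁₂.odd-cross-none (D₁₂.no-root-above 24 9 (d₁₂-odd-odd′ κ))
      }
    (even maxE ℕ.≤-refl refl) (D₁₂.even-value 12 5 ℕ.≤-refl (d₁₂-A κ))

  d₁₃-unit : ∀ x → (- + 48 * x + - + 24) * (+ 12 * x + + 5)
      ≡ + 1 [mod + 24 * x + + 11 ]
  d₁₃-unit x = congruent (divides (- + 24 * x + - + 11) (solve (x ∷ [])))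

  d₁₃-even-odd : ∀ x → (+ 30 * x + + 14) - (+ 24 * x + + 11) - (+ 12 * x + + 4) * (+ 12 * x + + 5) + (+ 24 * x + + 10) * (+ 12 * x + + 5)
      ≡ 0ℤ [mod + 24 * x + + 11 ]
  d₁₃-even-odd x = congruent (divides (+ 6 * x + + 3) (solve (x ∷ [])))

  d₁₃-even-odd′ : ∀ x → ((+ 30 * x + + 14) + (+ 24 * x + + 11) - (+ 0 * x + + 0)) + (+ 12 * x + + 6) * (+ 12 * x + + 5)
      ≡ + 24 * x + + 11 [mod + 48 * x + + 22 ]
  d₁₃-even-odd′ x = congruent (divides (+ 3 * x + + 2) (solve (x ∷ [])))

  d₁₃-even-even′ : ∀ x → ((+ 30 * x + + 14) + (+ 30 * x + + 14) - (+ 0 * x + + 0)) + (+ 0 * x + + 1) * (+ 12 * x + + 5)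
      ≡ + 24 * x + + 11 [mod + 48 * x + + 22 ]
  d₁₃-even-even′ x = congruent (divides (+ 0 * x + + 1) (solve (x ∷ [])))

  d₁₃-odd-odd′ : ∀ x → ((+ 24 * x + + 11) + (+ 24 * x + + 11) - (+ 0 * x + + 0)) + (+ 0 * x + + 0) * (+ 12 * x + + 5)
      ≡ 0ℤ [mod + 24 * x + + 11 ]
  d₁₃-odd-odd′ x = congruent (divides (+ 0 * x + + 2) (solve (x ∷ [])))

  d₁₃-A : ∀ x → (+ 30 * x + + 14) + (+ 12 * x + + 6) * (+ 12 * x + + 5)
      ≡ 0ℤ [mod + 24 * x + + 11 ]
  d₁₃-A x = congruent (divides (+ 6 * x + + 4) (solve (x ∷ [])))

  d₁₃-B : ∀ x → (+ 24 * x + + 11) + (+ 0 * x + + 0) * (+ 12 * x + + 5)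
      ≡ + 24 * x + + 11 [mod + 48 * x + + 22 ]
  d₁₃-B x = congruent (divides (+ 0 * x + + 0) (solve (x ∷ [])))

  module D₁₃ = PatternFacts (P₃ ⊟ᵖ P₁) (- + 48 * κ + - + 24) (d₁₃-unit κ)

  L₁-L₃-nearlyOrthogonal : NearlyOrthogonal n (L₁ k) (L₃ k)
  L₁-L₃-nearlyOrthogonal = D₁₃.separation⇒nearlyOrthogonal (c₁ k) (c₃ k) (difference-follows (c₁ k) (c₃ k) c₁-follows c₃-follows) refl
    (D₁₃.no-root-above 12 6 (d₁₃-A κ)) (D₁₃.no-root-half 0 0 (d₁₃-B κ))
    record
      { even-odd   = D₁₃.no-root-above 24 10 (d₁₃-even-odd κ)
      ; even-odd′  = D₁₃.no-root-half 12 6 (d₁₃-even-odd′ κ)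
      ; even-even′ = D₁₃.even-cross-none (D₁₃.no-root-half 0 1 (d₁₃-even-even′ κ))
      ; odd-odd′   = D₁₃.odd-cross-bottom (d₁₃-odd-odd′ κ)
      }
    (odd 0 z≤n refl) (D₁₃.odd-value 0 0 z≤n (d₁₃-B κ))

  d₂₃-unit : ∀ x → (+ 0 * x + + 1) * (+ 0 * x + + 1)
      ≡ + 1 [mod + 24 * x + + 11 ]
  d₂₃-unit x = congruent (divides (+ 0 * x + + 0) (solve (x ∷ [])))

  d₂₃-even-odd : ∀ x → (+ 0 * x + + 1) - (+ 12 * x + + 7) - (+ 12 * x + + 4) * (+ 0 * x + + 1) + (+ 24 * x + + 10) * (+ 0 * x + + 1)
      ≡ 0ℤ [mod + 24 * x + + 11 ]
  d₂₃-even-odd x = congruent (divides (+ 0 * x + + 0) (solve (x ∷ [])))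

  d₂₃-even-odd′ : ∀ x → ((+ 0 * x + + 1) + (+ 12 * x + + 7) - (+ 0 * x + + 0)) + (+ 12 * x + + 3) * (+ 0 * x + + 1)
      ≡ + 24 * x + + 11 [mod + 48 * x + + 22 ]
  d₂₃-even-odd′ x = congruent (divides (+ 0 * x + + 0) (solve (x ∷ [])))

  d₂₃-even-even′ : ∀ x → ((+ 0 * x + + 1) + (+ 0 * x + + 1) - (+ 0 * x + + 0)) + (+ 24 * x + + 9) * (+ 0 * x + + 1)
      ≡ + 24 * x + + 11 [mod + 48 * x + + 22 ]
  d₂₃-even-even′ x = congruent (divides (+ 0 * x + + 0) (solve (x ∷ [])))

  d₂₃-odd-odd′ : ∀ x → ((+ 12 * x + + 7) + (+ 12 * x + + 7) - (+ 0 * x + + 0)) + (+ 24 * x + + 8) * (+ 0 * x + + 1)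
      ≡ 0ℤ [mod + 24 * x + + 11 ]
  d₂₃-odd-odd′ x = congruent (divides (+ 0 * x + + 2) (solve (x ∷ [])))

  d₂₃-A : ∀ x → (+ 0 * x + + 1) + (+ 24 * x + + 10) * (+ 0 * x + + 1)
      ≡ + 24 * x + + 11 [mod + 48 * x + + 22 ]
  d₂₃-A x = congruent (divides (+ 0 * x + + 0) (solve (x ∷ [])))

  d₂₃-B : ∀ x → (+ 12 * x + + 7) + (+ 12 * x + + 4) * (+ 0 * x + + 1)
      ≡ + 24 * x + + 11 [mod + 48 * x + + 22 ]
  d₂₃-B x = congruent (divides (+ 0 * x + + 0) (solve (x ∷ [])))

  module D₂₃ = PatternFacts (P₃ ⊟ᵖ P₂) (+ 0 * κ + + 1) (d₂₃-unit κ)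

  L₂-L₃-nearlyOrthogonal : NearlyOrthogonal n (L₂ k) (L₃ k)
  L₂-L₃-nearlyOrthogonal = D₂₃.separation⇒nearlyOrthogonal (c₂ k) (c₃ k) (difference-follows (c₂ k) (c₃ k) c₂-follows c₃-follows) refl
    (D₂₃.no-root-half 24 10 (d₂₃-A κ)) (D₂₃.no-root-half 12 4 (d₂₃-B κ))
    record
      { even-odd   = D₂₃.no-root-above 24 10 (d₂₃-even-odd κ)
      ; even-odd′  = D₂₃.no-root-half 12 3 (d₂₃-even-odd′ κ)
      ; even-even′ = D₂₃.even-cross-none (D₂₃.no-root-half 24 9 (d₂₃-even-even′ κ))
      ; odd-odd′   = D₂₃.odd-cross-top (d₂₃-odd-odd′ κ)
      }
    (odd maxO ℕ.≤-refl refl) (D₂₃.odd-value 12 4 ℕ.≤-refl (d₂₃-B κ))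

theorem4 : (k : ℕ) →
    IsLatinSquare (L₁ k) × IsLatinSquare (L₂ k) × IsLatinSquare (L₃ k) ×
    NearlyOrthogonal (ord k) (L₁ k) (L₂ k) ×
    NearlyOrthogonal (ord k) (L₁ k) (L₃ k) ×
    NearlyOrthogonal (ord k) (L₂ k) (L₃ k)
theorem4 k =
  cyclic-isLatinSquare n id ,
  cyclic-isLatinSquare n c₂-injective ,
  cyclic-isLatinSquare n c₃-injective ,
  L₁-L₂-nearlyOrthogonal ,
  L₁-L₃-nearlyOrthogonal ,
  L₂-L₃-nearlyOrthogonal
  where
  open Construction k
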